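{- Let $f:\{0,1\}^n\to\{0,1\}^n$ be a Boolean network and let $i,j\in[n]$ be distinct. Some digraph in $\mathcal{G}(f)$ has no arc from $j$ to $i$ if and only if $f$ has a $2^{n-2}$-nice set.
   Context: A Boolean network with $n$ components is a map $f:\{0,1\}^n\to\{0,1\}^n$, $x\mapsto(f_1(x),\dots,f_n(x))$. For $i\in[n]$, $e_i$ is the configuration with a $1$ exactly in component $i$, and $x+y$ is componentwise addition modulo 2. The interaction graph $G(f)$ has vertex set $[n]$ and an arc from $j$ to $i$ (loops allowed) iff there is $x$ with $f_i(x)\neq f_i(x+e_j)$. Networks $f,h$ are isomorphic if $h\circ\pi=\pi\circ f$ for some permutation $\pi$ of $\{0,1\}^n$; $\mathcal{G}(f)$ is the set of $G(h)$ for all $h$ isomorphic to $f$. For $1\leq k\leq 2^{n-1}$, a $k$-nice set of $f$ is a set $A\subseteq\{0,1\}^n$ with $|A|=2k$ such that both $|f^{ -1}(A)|$ and $|f^{ -1}(A)\cap A|$ are even. -}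

module Defs where

open import Data.Nat using (ℕ; zero; suc; _+_; _*_; _^_)
open import Data.Nat.Divisibility using (_∣_)
open import Data.Bool using (Bool; true; false; not; _∧_)
open import Data.Fin using (Fin)
open import Data.Vec using (Vec; []; _∷_; lookup; updateAt)
open import Data.List using (List; []; _∷_; _++_; map; filterᵇ; length)
open import Data.Product using (Σ; _×_; ∃)
open import Relation.Binary.PropositionalEquality using (_≡_; _≢_)
open import Function.Bundles using (_↔_; Inverse)

Config : ℕ → Set
Config n = Vec Bool n

BN : ℕ → Set
BN n = Config n → Config n

flipAt : ∀ {n} → Fin n → Config n → Config n
flipAt j x = updateAt x j not

Arc : ∀ {n} → BN n → Fin n → Fin n → Set
Arc f j i = ∃ λ x → lookup (f x) i ≢ lookup (f (flipAt j x)) i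

Isomorphic : ∀ {n} → BN n → BN n → Set
Isomorphic {n} f h = Σ (Config n ↔ Config n) λ π →
  ∀ x → h (Inverse.to π x) ≡ Inverse.to π (f x)

allConfigs : (n : ℕ) → List (Config n)
allConfigs zero = [] ∷ []
allConfigs (suc n) = map (false ∷_) (allConfigs n) ++ map (true ∷_) (allConfigs n)

Subset : ℕ → Set
Subset n = Config n → Bool

card : ∀ {n} → Subset n → ℕ
card {n} A = length (filterᵇ A (allConfigs n))

Even : ℕ → Set
Even m = 2 ∣ m

Nice : ∀ {n} → BN n → ℕ → Subset n → Set
Nice f k A =
  card A ≡ 2 * k
  × Even (card (λ x → A (f x)))
  × Even (card (λ x → A (f x) ∧ A x))

-- If h = π ∘ f ∘ π⁻¹ has an i-th component not depending on x_j, then A = π⁻¹ {y | y_i = 1}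
-- has 2^(n-1) elements, and π maps f⁻¹(A) and f⁻¹(A) ∩ A onto sets closed under flipping
-- coordinate j, i.e. unions of pairs {y, y + e_j}; so A is 2^(n-2)-nice.
-- Conversely, if A is nice then the four classes {x | x ∈ A ⇔ a, f x ∈ A ⇔ b} all have even
-- size, so A and its complement can each be cut into 2^(n-2) pairs on which membership in
-- f⁻¹(A) is constant. Coordinates that record membership in A at position i and the position
-- within the pair at position j give π, and then h = π ∘ f ∘ π⁻¹ has no arc from j to i.
module Submission where

open import Defs
open import Data.Bool using (Bool; true; false; not; _∧_; T; if_then_else_)
open import Data.Bool.Properties using (T-irrelevant; ∧-comm) renaming (_≟_ to _≟ᵇ_)
open import Data.Empty using (⊥-elim)
open import Data.Fin using (Fin; zero; suc; punchIn; punchOut)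
open import Data.Fin.Properties
  using (+↔⊎; *↔×; 2↔Bool; 0↔⊥; 1↔⊤; cantor-schröder-bernstein; punchIn-punchOut)
open import Data.List using (List; []; _∷_; _++_; map; filterᵇ; length)
open import Data.List.Properties using (length-++; filter-++)
open import Data.Nat using (ℕ; zero; suc; _+_; _*_; _^_; _∸_)
open import Data.Nat.Divisibility using (divides; ∣m∣n⇒∣m+n; ∣m+n∣m⇒∣n)
open import Data.Nat.Properties
  using (+-identityʳ; *-comm; *-distribʳ-+; *-cancelʳ-≡; +-cancelˡ-≡)
open import Data.Product using (Σ; Σ-syntax; _×_; ∃; _,_; proj₁; proj₂; map₁; map₂)
open import Data.Product.Algebra using (×-comm; ×-distribʳ-⊎)
open import Data.Product.Function.NonDependent.Propositional using (_×-↔_)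
open import Data.Sum using (_⊎_; inj₁; inj₂)
import Data.Sum as Sum
open import Data.Sum.Function.Propositional using (_⊎-↔_)
open import Data.Unit using (tt)
open import Data.Vec using (Vec; []; _∷_; lookup; updateAt; insertAt; removeAt)
open import Data.Vec.Properties
  using (insertAt-lookup; removeAt-insertAt; insertAt-removeAt; lookup∘updateAt′)
open import Function using (_∘_; const)
open import Function.Bundles using (_↔_; _⇔_; Inverse; Injection; mk↔ₛ′; mk⇔)
open import Function.Properties.Inverse using (↔-refl; ↔-sym; ↔-trans; ↔⇒↣)
open import Level using (0ℓ)
open import Relation.Binary.PropositionalEquality
open import Relation.Nullary using (¬_; yes; no)
open import Relation.Nullary.Decidable using (T?)

open Inverse using (to; from; strictlyInverseˡ; strictlyInverseʳ)

count : ∀ {n} → Subset n → ℕ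
count {zero}  P = if P [] then 1 else 0
count {suc n} P = count (P ∘ (false ∷_)) + count (P ∘ (true ∷_))

length-filterᵇ-map : ∀ {A B : Set} (P : B → Bool) (g : A → B) (xs : List A) →
  length (filterᵇ P (map g xs)) ≡ length (filterᵇ (P ∘ g) xs)
length-filterᵇ-map P g [] = refl
length-filterᵇ-map P g (x ∷ xs) with P (g x)
... | true  = cong suc (length-filterᵇ-map P g xs)
... | false = length-filterᵇ-map P g xs

card≡count : ∀ {n} (P : Subset n) → card P ≡ count P
card≡count {zero} P with P []
... | true  = refl
... | false = refl
card≡count {suc n} P = begin
  length (filterᵇ P (map (false ∷_) xs ++ map (true ∷_) xs))
    ≡⟨ cong length (filter-++ (T? ∘ P) (map (false ∷_) xs) _) ⟩
  length (filterᵇ P (map (false ∷_) xs) ++ filterᵇ P (map (true ∷_) xs))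
    ≡⟨ length-++ (filterᵇ P (map (false ∷_) xs)) ⟩
  length (filterᵇ P (map (false ∷_) xs)) + length (filterᵇ P (map (true ∷_) xs))
    ≡⟨ cong₂ _+_ (half false) (half true) ⟩
  count P ∎
  where
  open ≡-Reasoning
  xs = allConfigs n
  half : ∀ b → length (filterᵇ P (map (b ∷_) xs)) ≡ count (P ∘ (b ∷_))
  half b = trans (length-filterᵇ-map P (b ∷_) xs) (card≡count (P ∘ (b ∷_)))

count-cong : ∀ {n} {P Q : Subset n} → (∀ x → P x ≡ Q x) → count P ≡ count Q
count-cong {zero}  P≡Q = cong (λ b → if b then 1 else 0) (P≡Q [])
count-cong {suc n} P≡Q =
  cong₂ _+_ (count-cong (P≡Q ∘ (false ∷_))) (count-cong (P≡Q ∘ (true ∷_)))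

k+k≡2*k : ∀ k → k + k ≡ 2 * k
k+k≡2*k k = cong (k +_) (sym (+-identityʳ k))

even-2* : ∀ k → Even (2 * k)
even-2* k = divides k (*-comm 2 k)

count-const-true : ∀ n → count {n} (const true) ≡ 2 ^ n
count-const-true zero    = refl
count-const-true (suc n) =
  trans (cong₂ _+_ (count-const-true n) (count-const-true n)) (k+k≡2*k (2 ^ n))

count-const-false : ∀ n → count {n} (const false) ≡ 0
count-const-false zero    = refl
count-const-false (suc n) = cong₂ _+_ (count-const-false n) (count-const-false n)

count-lookup : ∀ {n} (i : Fin (suc n)) → count (λ y → lookup y i) ≡ 2 ^ n
count-lookup {n} zero =
  trans (cong (_+ count {n} (const true)) (count-const-false n)) (count-const-true n)
count-lookup {suc n} (suc i) =
  trans (cong₂ _+_ (count-lookup i) (count-lookup i)) (k+k≡2*k (2 ^ n))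

flip-invariant⇒even-count : ∀ {n} (j : Fin n) (P : Subset n) →
  (∀ x → P (flipAt j x) ≡ P x) → Even (count P)
flip-invariant⇒even-count zero P inv =
  divides (count (P ∘ (false ∷_))) (begin
    count (P ∘ (false ∷_)) + count (P ∘ (true ∷_))
      ≡⟨ cong (count (P ∘ (false ∷_)) +_) (count-cong (inv ∘ (false ∷_))) ⟩
    count (P ∘ (false ∷_)) + count (P ∘ (false ∷_))
      ≡⟨ k+k≡2*k (count (P ∘ (false ∷_))) ⟩
    2 * count (P ∘ (false ∷_))
      ≡⟨ *-comm 2 (count (P ∘ (false ∷_))) ⟩
    count (P ∘ (false ∷_)) * 2 ∎)
  where open ≡-Reasoning
flip-invariant⇒even-count (suc j) P inv =
  ∣m∣n⇒∣m+n (flip-invariant⇒even-count j (P ∘ (false ∷_)) (inv ∘ (false ∷_)))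
            (flip-invariant⇒even-count j (P ∘ (true ∷_)) (inv ∘ (true ∷_)))

Members : ∀ {X : Set} → (X → Bool) → Set
Members {X} P = Σ X (T ∘ P)

Members-≡ : ∀ {X : Set} {P : X → Bool} {x y : X} {s : T (P x)} {t : T (P y)} →
  x ≡ y → _≡_ {A = Members P} (x , s) (y , t)
Members-≡ {x = x} refl = cong (x ,_) (T-irrelevant _ _)

Fin-cong : ∀ {a b} → a ≡ b → Fin a ↔ Fin b
Fin-cong refl = ↔-refl

Fin-↔⇒≡ : ∀ {a b} → Fin a ↔ Fin b → a ≡ b
Fin-↔⇒≡ e =
  cantor-schröder-bernstein (Injection.injective (↔⇒↣ e)) (Injection.injective (↔⇒↣ (↔-sym e)))

T↔Fin : ∀ b → T b ↔ Fin (if b then 1 else 0)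
T↔Fin true  = ↔-sym 1↔⊤
T↔Fin false = ↔-sym 0↔⊥

Members-[] : (P : Subset 0) → T (P []) ↔ Members P
Members-[] P = mk↔ₛ′ ([] ,_) (λ { ([] , t) → t }) (λ { ([] , _) → refl }) (λ _ → refl)

Members-∷ : ∀ {n} (P : Subset (suc n)) →
  (Members (P ∘ (false ∷_)) ⊎ Members (P ∘ (true ∷_))) ↔ Members P
Members-∷ P = mk↔ₛ′ to′ from′ to∘from (λ { (inj₁ _) → refl ; (inj₂ _) → refl })
  where
  to′ : Members (P ∘ (false ∷_)) ⊎ Members (P ∘ (true ∷_)) → Members P
  to′ (inj₁ (x , t)) = false ∷ x , t
  to′ (inj₂ (x , t)) = true ∷ x , t
  from′ : Members P → Members (P ∘ (false ∷_)) ⊎ Members (P ∘ (true ∷_))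
  from′ (false ∷ x , t) = inj₁ (x , t)
  from′ (true ∷ x , t)  = inj₂ (x , t)
  to∘from : ∀ s → to′ (from′ s) ≡ s
  to∘from (false ∷ x , t) = refl
  to∘from (true ∷ x , t)  = refl

enumerate : ∀ {n} (P : Subset n) → Fin (count P) ↔ Members P
enumerate {zero}  P = ↔-trans (↔-sym (T↔Fin (P []))) (Members-[] P)
enumerate {suc n} P =
  ↔-trans +↔⊎
    (↔-trans (enumerate (P ∘ (false ∷_)) ⊎-↔ enumerate (P ∘ (true ∷_))) (Members-∷ P))

Members-∘-↔ : ∀ {X Y : Set} (e : X ↔ Y) (P : Y → Bool) → Members (P ∘ to e) ↔ Members P
Members-∘-↔ e P = mk↔ₛ′
  (λ { (x , t) → to e x , t })
  (λ { (y , t) → from e y , subst (T ∘ P) (sym (strictlyInverseˡ e y)) t })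
  (λ { (y , t) → Members-≡ (strictlyInverseˡ e y) })
  (λ { (x , t) → Members-≡ (strictlyInverseʳ e x) })

count-∘-↔ : ∀ {n} (π : Config n ↔ Config n) (P : Subset n) →
  count (P ∘ to π) ≡ count P
count-∘-↔ π P =
  Fin-↔⇒≡ (↔-trans (enumerate (P ∘ to π))
    (↔-trans (Members-∘-↔ π P) (↔-sym (enumerate P))))

Members-const-true : ∀ {X : Set} → X ↔ Members {X} (const true)
Members-const-true = mk↔ₛ′ (_, tt) proj₁ (λ _ → refl) (λ _ → refl)

Config↔Fin : ∀ m → Config m ↔ Fin (2 ^ m)
Config↔Fin m = ↔-trans Members-const-true
  (↔-trans (↔-sym (enumerate (const true))) (Fin-cong (count-const-true m)))

T-∧-fst : ∀ p q → T (p ∧ q) → T p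
T-∧-fst true q _ = tt

T-∧-snd≡true : ∀ p q → T (p ∧ q) → q ≡ true
T-∧-snd≡true true true _ = refl

T-∧-snd≡false : ∀ p q → T (p ∧ not q) → q ≡ false
T-∧-snd≡false true false _ = refl

T-∧-cases : ∀ p q → T p → T (p ∧ q) ⊎ T (p ∧ not q)
T-∧-cases true true  _ = inj₁ tt
T-∧-cases true false _ = inj₂ tt

T-∧-cases-inj₁ : ∀ p q (t : T (p ∧ q)) → T-∧-cases p q (T-∧-fst p q t) ≡ inj₁ t
T-∧-cases-inj₁ true true _ = refl

T-∧-cases-inj₂ : ∀ p q (t : T (p ∧ not q)) →
  T-∧-cases p q (T-∧-fst p (not q) t) ≡ inj₂ t
T-∧-cases-inj₂ true false _ = refl

Members-split : ∀ {X : Set} (P Q : X → Bool) →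
  Members P ↔ (Members (λ x → P x ∧ Q x) ⊎ Members (λ x → P x ∧ not (Q x)))
Members-split P Q = mk↔ₛ′ to′ from′ to∘from from∘to
  where
  to′ : Members P → Members (λ x → P x ∧ Q x) ⊎ Members (λ x → P x ∧ not (Q x))
  to′ (x , t) = Sum.map (x ,_) (x ,_) (T-∧-cases (P x) (Q x) t)
  from′ : Members (λ x → P x ∧ Q x) ⊎ Members (λ x → P x ∧ not (Q x)) → Members P
  from′ (inj₁ (x , t)) = x , T-∧-fst (P x) (Q x) t
  from′ (inj₂ (x , t)) = x , T-∧-fst (P x) (not (Q x)) t
  to∘from : ∀ s → to′ (from′ s) ≡ s
  to∘from (inj₁ (x , t)) = cong (Sum.map (x ,_) (x ,_)) (T-∧-cases-inj₁ (P x) (Q x) t)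
  to∘from (inj₂ (x , t)) = cong (Sum.map (x ,_) (x ,_)) (T-∧-cases-inj₂ (P x) (Q x) t)
  from∘to : ∀ s → from′ (to′ s) ≡ s
  from∘to (x , t) with T-∧-cases (P x) (Q x) t
  ... | inj₁ _ = Members-≡ refl
  ... | inj₂ _ = Members-≡ refl

count-split : ∀ {n} (P Q : Subset n) →
  count P ≡ count (λ x → P x ∧ Q x) + count (λ x → P x ∧ not (Q x))
count-split P Q = Fin-↔⇒≡ (↔-trans (enumerate P) (↔-trans (Members-split P Q)
  (↔-trans (↔-sym (enumerate _) ⊎-↔ ↔-sym (enumerate _)) (↔-sym +↔⊎))))

even-split : ∀ {n} (P Q : Subset n) → Even (count P) → Even (count (λ x → P x ∧ Q x)) →
  Even (count (λ x → P x ∧ not (Q x)))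
even-split P Q even-P even-P∧Q = ∣m+n∣m⇒∣n (subst Even (count-split P Q) even-P) even-P∧Q

count-complement : ∀ {n} (P : Subset n) → count P + count (not ∘ P) ≡ 2 ^ n
count-complement {n} P = trans (sym (count-split (const true) P)) (count-const-true n)

Pairing : ∀ {n} → ℕ → Subset n → Subset n → Set
Pairing m S B = Σ[ e ∈ Members S ↔ (Bool × Config m) ]
  (∀ z z' r → B (proj₁ (from e (z , r))) ≡ B (proj₁ (from e (z' , r))))

pair-up : ∀ {n} m (S B : Subset n) →
  Even (count (λ x → S x ∧ B x)) → Even (count (λ x → S x ∧ not (B x))) →
  count S ≡ 2 * 2 ^ m → Pairing m S B
pair-up {n} m S B (divides p |S∧B|) (divides q |S∧¬B|) |S| = e , B-independent
  where
  open ≡-Reasoning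
  p+q≡2^m : p + q ≡ 2 ^ m
  p+q≡2^m = *-cancelʳ-≡ (p + q) (2 ^ m) 2 (begin
    (p + q) * 2
      ≡⟨ *-distribʳ-+ 2 p q ⟩
    p * 2 + q * 2
      ≡⟨ sym (cong₂ _+_ |S∧B| |S∧¬B|) ⟩
    count (λ x → S x ∧ B x) + count (λ x → S x ∧ not (B x))
      ≡⟨ sym (count-split S B) ⟩
    count S
      ≡⟨ trans |S| (*-comm 2 (2 ^ m)) ⟩
    2 ^ m * 2 ∎)
  pairs : ∀ {P : Subset n} {c} → count P ≡ c * 2 → Members P ↔ (Fin c × Fin 2)
  pairs {P} |P| = ↔-trans (↔-sym (enumerate P)) (↔-trans (Fin-cong |P|) *↔×)
  layers : Members S ↔ ((Fin p ⊎ Fin q) × Fin 2)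
  layers = ↔-trans (Members-split S B)
    (↔-trans (pairs |S∧B| ⊎-↔ pairs |S∧¬B|)
      (↔-sym (×-distribʳ-⊎ 0ℓ (Fin 2) (Fin p) (Fin q))))
  B-layer : ∀ w c → B (proj₁ (from layers (w , c))) ≡ Sum.[ const true , const false ]′ w
  B-layer (inj₁ a) c = T-∧-snd≡true _ _ (proj₂ (from (pairs |S∧B|) (a , c)))
  B-layer (inj₂ b) c = T-∧-snd≡false _ _ (proj₂ (from (pairs |S∧¬B|) (b , c)))
  index : (Fin p ⊎ Fin q) ↔ Config m
  index = ↔-trans (↔-sym +↔⊎) (↔-trans (Fin-cong p+q≡2^m) (↔-sym (Config↔Fin m)))
  e : Members S ↔ (Bool × Config m)
  e = ↔-trans layers (↔-trans (×-comm _ _) (2↔Bool ×-↔ index))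
  B-independent : ∀ z z' r → B (proj₁ (from e (z , r))) ≡ B (proj₁ (from e (z' , r)))
  B-independent z z' r =
    trans (B-layer (from index r) (from 2↔Bool z)) (sym (B-layer (from index r) (from 2↔Bool z')))

⊎-self↔Bool× : ∀ {Y : Set} → (Y ⊎ Y) ↔ (Bool × Y)
⊎-self↔Bool× = mk↔ₛ′ Sum.[ (true ,_) , (false ,_) ]′
  (λ { (true , y) → inj₁ y ; (false , y) → inj₂ y })
  (λ { (true , _) → refl ; (false , _) → refl })
  (λ { (inj₁ _) → refl ; (inj₂ _) → refl })

nice-coordinates : ∀ m (A B : Subset (suc (suc m))) →
  count A ≡ 2 * 2 ^ m → Even (count B) → Even (count (λ x → B x ∧ A x)) →
  Σ[ Ψ ∈ Config (suc (suc m)) ↔ (Bool × Bool × Config m) ]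
    (∀ w → A (from Ψ w) ≡ proj₁ w) ×
    (∀ a z z' r → B (from Ψ (a , z , r)) ≡ B (from Ψ (a , z' , r)))
nice-coordinates m A B |A| even-B even-B∧A = Ψ , A-first , B-independent
  where
  open ≡-Reasoning
  |¬A| : count (not ∘ A) ≡ 2 * 2 ^ m
  |¬A| = +-cancelˡ-≡ (count A) _ _ (begin
    count A + count (not ∘ A) ≡⟨ count-complement A ⟩
    2 * (2 * 2 ^ m)           ≡⟨ sym (k+k≡2*k (2 * 2 ^ m)) ⟩
    2 * 2 ^ m + 2 * 2 ^ m     ≡⟨ cong (_+ 2 * 2 ^ m) (sym |A|) ⟩
    count A + 2 * 2 ^ m       ∎)
  even-A∧B : Even (count (λ x → A x ∧ B x))
  even-A∧B = subst Even (count-cong (λ x → ∧-comm (B x) (A x))) even-B∧A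
  even-¬A∧B : Even (count (λ x → not (A x) ∧ B x))
  even-¬A∧B =
    subst Even (count-cong (λ x → ∧-comm (B x) (not (A x)))) (even-split B A even-B even-B∧A)
  in-A : Pairing m A B
  in-A = pair-up m A B even-A∧B
    (even-split A B (subst Even (sym |A|) (even-2* (2 ^ m))) even-A∧B) |A|
  in-¬A : Pairing m (not ∘ A) B
  in-¬A = pair-up m (not ∘ A) B even-¬A∧B
    (even-split (not ∘ A) B (subst Even (sym |¬A|) (even-2* (2 ^ m))) even-¬A∧B) |¬A|
  Ψ : Config (suc (suc m)) ↔ (Bool × Bool × Config m)
  Ψ = ↔-trans Members-const-true (↔-trans (Members-split (const true) A)
        (↔-trans (proj₁ in-A ⊎-↔ proj₁ in-¬A) ⊎-self↔Bool×))
  A-first : ∀ w → A (from Ψ w) ≡ proj₁ w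
  A-first (true , y)  = T-∧-snd≡true true (A _) (proj₂ (from (proj₁ in-A) y))
  A-first (false , y) = T-∧-snd≡false true (A _) (proj₂ (from (proj₁ in-¬A) y))
  B-independent : ∀ a z z' r → B (from Ψ (a , z , r)) ≡ B (from Ψ (a , z' , r))
  B-independent true  = proj₂ in-A
  B-independent false = proj₂ in-¬A

updateAt-insertAt : ∀ {A : Set} {n} (xs : Vec A n) (k : Fin (suc n)) (v : A) (g : A → A) →
  updateAt (insertAt xs k v) k g ≡ insertAt xs k (g v)
updateAt-insertAt xs       zero    v g = refl
updateAt-insertAt (x ∷ xs) (suc k) v g = cong (x ∷_) (updateAt-insertAt xs k v g)

updateAt-insertAt-punchIn : ∀ {A : Set} {n} (xs : Vec A n) (i : Fin (suc n)) (k : Fin n) (v : A)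
  (g : A → A) → updateAt (insertAt xs i v) (punchIn i k) g ≡ insertAt (updateAt xs k g) i v
updateAt-insertAt-punchIn xs       zero    k       v g = refl
updateAt-insertAt-punchIn (x ∷ xs) (suc i) zero    v g = refl
updateAt-insertAt-punchIn (x ∷ xs) (suc i) (suc k) v g =
  cong (x ∷_) (updateAt-insertAt-punchIn xs i k v g)

module _ {m} {i j : Fin (suc (suc m))} (i≢j : i ≢ j) where

  private
    j′ : Fin (suc m)
    j′ = punchOut i≢j

  place : (Bool × Bool × Config m) ↔ Config (suc (suc m))
  place = mk↔ₛ′ to′ from′ to∘from from∘to
    where
    to′ : Bool × Bool × Config m → Config (suc (suc m))
    to′ (a , z , r) = insertAt (insertAt r j′ z) i a
    from′ : Config (suc (suc m)) → Bool × Bool × Config m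
    from′ y = lookup y i , lookup (removeAt y i) j′ , removeAt (removeAt y i) j′
    to∘from : ∀ y → to′ (from′ y) ≡ y
    to∘from y rewrite insertAt-removeAt (removeAt y i) j′ = insertAt-removeAt y i
    from∘to : ∀ w → from′ (to′ w) ≡ w
    from∘to (a , z , r)
      rewrite insertAt-lookup (insertAt r j′ z) i a
            | removeAt-insertAt (insertAt r j′ z) i a
            | insertAt-lookup r j′ z
            | removeAt-insertAt r j′ z = refl

  lookup-place : ∀ w → lookup (to place w) i ≡ proj₁ w
  lookup-place (a , z , r) = insertAt-lookup (insertAt r j′ z) i a

  flipAt-place : ∀ w → flipAt j (to place w) ≡ to place (map₂ (map₁ not) w)
  flipAt-place (a , z , r) = begin
    updateAt (insertAt (insertAt r j′ z) i a) j not
      ≡⟨ cong (λ k → updateAt (insertAt (insertAt r j′ z) i a) k not)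
              (sym (punchIn-punchOut i≢j)) ⟩
    updateAt (insertAt (insertAt r j′ z) i a) (punchIn i j′) not
      ≡⟨ updateAt-insertAt-punchIn (insertAt r j′ z) i j′ a not ⟩
    insertAt (updateAt (insertAt r j′ z) j′ not) i a
      ≡⟨ cong (λ v → insertAt v i a) (updateAt-insertAt r j′ z not) ⟩
    insertAt (insertAt r j′ (not z)) i a ∎
    where open ≡-Reasoning

  from-place-flipAt : ∀ y → from place (flipAt j y) ≡ map₂ (map₁ not) (from place y)
  from-place-flipAt y = begin
    from place (flipAt j y)
      ≡⟨ cong (from place ∘ flipAt j) (sym (strictlyInverseˡ place y)) ⟩
    from place (flipAt j (to place (from place y)))
      ≡⟨ cong (from place) (flipAt-place (from place y)) ⟩
    from place (to place (map₂ (map₁ not) (from place y)))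
      ≡⟨ strictlyInverseʳ place (map₂ (map₁ not) (from place y)) ⟩
    map₂ (map₁ not) (from place y) ∎
    where open ≡-Reasoning

¬Arc⇒flip-invariant : ∀ {n} (h : BN n) (i j : Fin n) → ¬ Arc h j i →
  ∀ x → lookup (h (flipAt j x)) i ≡ lookup (h x) i
¬Arc⇒flip-invariant h i j ¬arc x with lookup (h x) i ≟ᵇ lookup (h (flipAt j x)) i
... | yes eq = sym eq
... | no  ne = ⊥-elim (¬arc (x , ne))

flip-invariant⇒¬Arc : ∀ {n} (h : BN n) (i j : Fin n) →
  (∀ x → lookup (h (flipAt j x)) i ≡ lookup (h x) i) → ¬ Arc h j i
flip-invariant⇒¬Arc h i j inv (x , ne) = ne (sym (inv x))

no-arc⇒nice : ∀ m (f : BN (suc (suc m))) (i j : Fin (suc (suc m))) → i ≢ j →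
  (∃ λ h → Isomorphic f h × ¬ Arc h j i) → ∃ λ A → Nice f (2 ^ m) A
no-arc⇒nice m f i j i≢j (h , (π , h∘π≗π∘f) , ¬arc) =
  A , |A| , even-f⁻¹A , even-f⁻¹A∩A
  where
  A : Subset (suc (suc m))
  A x = lookup (to π x) i
  hᵢ-invariant : ∀ y → lookup (h (flipAt j y)) i ≡ lookup (h y) i
  hᵢ-invariant = ¬Arc⇒flip-invariant h i j ¬arc
  even-along-π : (P : Subset (suc (suc m))) → (∀ y → P (flipAt j y) ≡ P y) →
    Even (count (P ∘ to π))
  even-along-π P inv = subst Even (sym (count-∘-↔ π P)) (flip-invariant⇒even-count j P inv)
  hᵢ∘π : ∀ x → A (f x) ≡ lookup (h (to π x)) i
  hᵢ∘π x = cong (λ y → lookup y i) (sym (h∘π≗π∘f x))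
  |A| : card A ≡ 2 * 2 ^ m
  |A| = trans (card≡count A) (trans (count-∘-↔ π (λ y → lookup y i)) (count-lookup i))
  even-f⁻¹A : Even (card (A ∘ f))
  even-f⁻¹A = subst Even (sym (trans (card≡count (A ∘ f)) (count-cong hᵢ∘π)))
    (even-along-π (λ y → lookup (h y) i) hᵢ-invariant)
  even-f⁻¹A∩A : Even (card (λ x → A (f x) ∧ A x))
  even-f⁻¹A∩A =
    subst Even (sym (trans (card≡count (λ x → A (f x) ∧ A x))
                           (count-cong (λ x → cong (_∧ A x) (hᵢ∘π x)))))
      (even-along-π (λ y → lookup (h y) i ∧ lookup y i)
        (λ y → cong₂ _∧_ (hᵢ-invariant y) (lookup∘updateAt′ i j i≢j y)))

coordinates⇒no-arc : ∀ m (f : BN (suc (suc m))) {i j : Fin (suc (suc m))} (i≢j : i ≢ j)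
  (A : Subset (suc (suc m))) (Ψ : Config (suc (suc m)) ↔ (Bool × Bool × Config m)) →
  (∀ w → A (from Ψ w) ≡ proj₁ w) →
  (∀ w → A (f (from Ψ (map₂ (map₁ not) w))) ≡ A (f (from Ψ w))) →
  ∃ λ h → Isomorphic f h × ¬ Arc h j i
coordinates⇒no-arc m f {i} {j} i≢j A Ψ A-first B-flip =
  h , (π , h∘π≗π∘f) , flip-invariant⇒¬Arc h i j hᵢ-invariant
  where
  π : Config (suc (suc m)) ↔ Config (suc (suc m))
  π = ↔-trans Ψ (place i≢j)
  h : BN (suc (suc m))
  h y = to π (f (from π y))
  h∘π≗π∘f : ∀ x → h (to π x) ≡ to π (f x)
  h∘π≗π∘f x = cong (to π ∘ f) (strictlyInverseʳ π x)
  A≡proj₁∘Ψ : ∀ x → A x ≡ proj₁ (to Ψ x)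
  A≡proj₁∘Ψ x = trans (cong A (sym (strictlyInverseʳ Ψ x))) (A-first (to Ψ x))
  hᵢ : ∀ y → lookup (h y) i ≡ A (f (from π y))
  hᵢ y = trans (lookup-place i≢j (to Ψ (f (from π y)))) (sym (A≡proj₁∘Ψ (f (from π y))))
  hᵢ-invariant : ∀ y → lookup (h (flipAt j y)) i ≡ lookup (h y) i
  hᵢ-invariant y = begin
    lookup (h (flipAt j y)) i
      ≡⟨ hᵢ (flipAt j y) ⟩
    A (f (from Ψ (from (place i≢j) (flipAt j y))))
      ≡⟨ cong (A ∘ f ∘ from Ψ) (from-place-flipAt i≢j y) ⟩
    A (f (from Ψ (map₂ (map₁ not) (from (place i≢j) y))))
      ≡⟨ B-flip (from (place i≢j) y) ⟩
    A (f (from π y))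
      ≡⟨ sym (hᵢ y) ⟩
    lookup (h y) i ∎
    where open ≡-Reasoning

nice⇒no-arc : ∀ m (f : BN (suc (suc m))) (i j : Fin (suc (suc m))) → i ≢ j →
  (∃ λ A → Nice f (2 ^ m) A) → ∃ λ h → Isomorphic f h × ¬ Arc h j i
nice⇒no-arc m f i j i≢j (A , |A| , even-f⁻¹A , even-f⁻¹A∩A) =
  let Ψ , A-first , B-independent =
        nice-coordinates m A (A ∘ f) (trans (sym (card≡count A)) |A|)
          (subst Even (card≡count (A ∘ f)) even-f⁻¹A)
          (subst Even (card≡count (λ x → A (f x) ∧ A x)) even-f⁻¹A∩A)
  in coordinates⇒no-arc m f i≢j A Ψ A-first (λ (a , z , r) → B-independent a (not z) z r)

lemma4 : (n : ℕ) (f : BN n) (i j : Fin n) → i ≢ j →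
    ((∃ λ (h : BN n) → Isomorphic f h × ¬ Arc h j i)
      ⇔ (∃ λ (A : Subset n) → Nice f (2 ^ (n ∸ 2)) A))
lemma4 (suc (suc m)) f i j i≢j = mk⇔ (no-arc⇒nice m f i j i≢j) (nice⇒no-arc m f i j i≢j)
lemma4 (suc zero) f zero zero i≢j = ⊥-elim (i≢j refl)
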